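{- Let $m,n\ge0$ and let $\lambda$ be a partition of length at most $m+n$, viewed as a sequence of length exactly $m+n$. Then the map $$\pi\mapsto\left(\mu(\pi)+\lambda_{V(\pi)},\ \nu(\pi)'+\lambda_{H(\pi)}\right)$$ is a bijection from $\mathfrak P(n,m)$ onto the set of pairs of partitions $(\mu,\nu)$ with $\mu\star_{m,n}\nu=\lambda$. Moreover, $\varepsilon_{m,n}\left(\mu(\pi)+\lambda_{V(\pi)},\nu(\pi)'+\lambda_{H(\pi)}\right)=(-1)^{|\nu(\pi)|}=(-1)^{mn-|\mu(\pi)|}$.
   Context: $\mathfrak P(n,m)$ is the set of lattice paths from the top-right to the bottom-left corner of an $n\times m$ rectangle (width $n$, height $m$) using unit west and south steps; such a path has $m+n$ steps. $V(\pi)=(V_1<\dots<V_m)$ and $H(\pi)=(H_1<\dots<H_n)$ are the sequences of times (indices in $\{1,\dots,m+n\}$) of the south and west steps of $\pi$. $\mu(\pi)$ is the partition of the boxes above $\pi$: $\mu(\pi)_i=n+i-V_i$ for $1\le i\le m$; $\nu(\pi)$ is the partition formed by the boxes below $\pi$ (rotated by 180°), given by $\nu(\pi)'_j=m+j-H_j$ for $1\le j\le n$, where $'$ denotes conjugation. For a sequence $\lambda$ and an increasing index sequence $K$, $\lambda_K=(\lambda_{K_1},\lambda_{K_2},\dots)$; sums are entrywise; $|\cdot|$ is the size. With $\rho_j=(j-1,\dots,1,0)$, the $(m,n)$-overlap $\mu\star_{m,n}\nu$ of partitions of lengths at most $m,n$ is the partition $\kappa$ with $\kappa+\rho_{m+n}$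 a rearrangement of the concatenation $(\mu+\rho_m)\cup(\nu+\rho_n)$ if it exists (otherwise it is the symbol $\infty$), and $\varepsilon_{m,n}(\mu,\nu)$ is the sign of the permutation sorting $(\mu+\rho_m)\cup(\nu+\rho_n)$ into $\kappa+\rho_{m+n}$. -}

module Defs where

open import Data.Nat using (ℕ; zero; suc; _+_; _*_; _∸_; _≤_; _<ᵇ_)
open import Data.Bool using (Bool; true; false; if_then_else_)
open import Data.Integer as ℤ using (ℤ)
open import Data.List using (List; []; _∷_; _++_; length; zipWith; map; downFrom)
open import Data.Nat.ListAction using (sum)
open import Data.List.Relation.Unary.Linked using (Linked)
open import Data.List.Relation.Binary.Permutation.Propositional using (_↭_)
open import Data.Product using (_×_; _,_)
open import Relation.Binary.PropositionalEquality using (_≡_)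

data Step : Set where
  S W : Step

countS : List Step → ℕ
countS []       = 0
countS (S ∷ p)  = suc (countS p)
countS (W ∷ p)  = countS p

-- p ∈ 𝔓(n,m): m + n steps, exactly m south steps (hence n west steps).
IsPath : ℕ → ℕ → List Step → Set
IsPath n m p = length p ≡ m + n × countS p ≡ m

-- 1-based times of the steps of a given kind, starting at time k.
posOf : Step → ℕ → List Step → List ℕ
posOf s k []      = []
posOf S k (S ∷ p) = k ∷ posOf S (suc k) p
posOf S k (W ∷ p) = posOf S (suc k) p
posOf W k (W ∷ p) = k ∷ posOf W (suc k) p
posOf W k (S ∷ p) = posOf W (suc k) p

V : List Step → List ℕ
V = posOf S 1

H : List Step → List ℕ
H = posOf W 1

withIdx : (ℕ → ℕ → ℕ) → ℕ → List ℕ → List ℕ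
withIdx f i []       = []
withIdx f i (x ∷ xs) = f i x ∷ withIdx f (suc i) xs

muOf : ℕ → List Step → List ℕ
muOf n p = withIdx (λ i v → n + i ∸ v) 1 (V p)

nuConjOf : ℕ → List Step → List ℕ
nuConjOf m p = withIdx (λ j h → m + j ∸ h) 1 (H p)

-- conjugate of a partition, as a sequence of length k: c_i = #{j : p_j ≥ i}
countGe : ℕ → List ℕ → ℕ
countGe i []       = 0
countGe i (x ∷ xs) = if x <ᵇ i then countGe i xs else suc (countGe i xs)

conj : ℕ → List ℕ → List ℕ
conj k p = withIdx (λ i _ → countGe i p) 1 (downFrom k)

nuOf : ℕ → List Step → List ℕ
nuOf m p = conj m (nuConjOf m p)

size : List ℕ → ℕ
size = sum

-- 1-based lookup (value 0 outside the range; never used out of range here)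
nth : List ℕ → ℕ → ℕ
nth []       _             = 0
nth (x ∷ xs) 0             = 0
nth (x ∷ xs) 1             = x
nth (x ∷ xs) (suc (suc k)) = nth xs (suc k)

sub : List ℕ → List ℕ → List ℕ
sub lam K = map (nth lam) K

_⊕_ : List ℕ → List ℕ → List ℕ
_⊕_ = zipWith _+_

ρ : ℕ → List ℕ
ρ = downFrom

IsPartLen : ℕ → List ℕ → Set
IsPartLen k xs = length xs ≡ k × Linked (λ a b → b ≤ a) xs

Overlap : ℕ → ℕ → List ℕ → List ℕ → List ℕ → Set
Overlap m n μ ν κ =
  IsPartLen (m + n) κ × ((κ ⊕ ρ (m + n)) ↭ ((μ ⊕ ρ m) ++ (ν ⊕ ρ n)))

Target : ℕ → ℕ → List ℕ → List ℕ × List ℕ → Set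
Target m n lam (μ , ν) = IsPartLen m μ × IsPartLen n ν × Overlap m n μ ν lam

-- number of inversions w.r.t. decreasing order: pairs i < j with a_i < a_j
countGt : ℕ → List ℕ → ℕ
countGt x []       = 0
countGt x (y ∷ ys) = if x <ᵇ y then suc (countGt x ys) else countGt x ys

inv : List ℕ → ℕ
inv []       = 0
inv (x ∷ xs) = countGt x xs + inv xs

negPow : ℕ → ℤ
negPow zero    = ℤ.+ 1
negPow (suc k) = ℤ.- negPow k

-- ε_{m,n}(μ,ν): sign of the permutation sorting (μ+ρ_m)∪(ν+ρ_n) decreasingly
-- (= (-1)^{#inversions}; entries are distinct whenever the overlap exists)
ε : ℕ → ℕ → List ℕ → List ℕ → ℤ
ε m n μ ν = negPow (inv ((μ ⊕ ρ m) ++ (ν ⊕ ρ n)))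

Φ : ℕ → ℕ → List ℕ → List Step → List ℕ × List ℕ
Φ m n lam p = (muOf n p ⊕ sub lam (V p)) , (nuConjOf m p ⊕ sub lam (H p))

module Submission where

-- Put A = λ + ρ_{m+n}; since λ is a partition, A is strictly decreasing.  A path
-- π splits the times 1..m+n into its south times V and west times H, and
-- "picking" the entries of A at these times splits A into two strictly
-- decreasing lists A_V and A_H with A ↭ A_V ++ A_H.  The heart of the proof is
-- the identity
--     (μ(π) + λ_V) + ρ_m = A_V,     (ν(π)' + λ_H) + ρ_n = A_H,
-- which holds because μ(π)_i = n + i - V_i is the number of west steps after
-- the i-th south step, and adding ρ_m adds the number of south steps after it,
-- giving m + n - V_i = (ρ_{m+n})_{V_i}.  Given this identity, membership in the
-- target is "picking preserves strict decrease", injectivity is "a strictly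
-- decreasing list determines which entries were picked", and surjectivity is
-- "two strictly decreasing lists whose concatenation is a rearrangement of A
-- arise by picking".  For the sign, the inversions of A_V ++ A_H are exactly
-- the pairs (west step, later south step), whose number is |ν(π)|; the pairs
-- of the opposite kind number |μ(π)|, and all pairs together number mn.

open import Defs
open import Data.Nat using (ℕ; zero; suc; _+_; _*_; _∸_; _≤_; _<_; _>_; _≥_; _<ᵇ_; _⊓_; s≤s)
open import Data.Nat.Properties
open import Data.Nat.Tactic.RingSolver using (solve-∀)
open import Data.Nat.ListAction using (sum)
open import Data.Bool using (true; false; if_then_else_)
open import Data.List using (List; []; _∷_; _++_; length; zipWith; map; downFrom)
open import Data.List.Properties using (length-zipWith; length-downFrom; zipWith-zeroʳ; ∷-injectiveˡ; ∷-injectiveʳ)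
open import Data.List.Relation.Unary.All as All using (All; []; _∷_)
open import Data.List.Relation.Unary.Any using (here; there)
open import Data.List.Relation.Unary.AllPairs using (AllPairs; []; _∷_)
open import Data.List.Relation.Unary.Linked using (Linked; []; [-]; _∷_)
open import Data.List.Relation.Unary.Linked.Properties using (Linked⇒AllPairs; AllPairs⇒Linked)
open import Data.List.Membership.Propositional using (_∈_)
open import Data.List.Membership.Propositional.Properties using (∈-++⁻; ∈-++⁺ʳ)
open import Data.List.Relation.Binary.Permutation.Propositional using (_↭_; ↭-sym; ↭-trans; ↭-prep; ↭-refl)
open import Data.List.Relation.Binary.Permutation.Propositional.Properties using (drop-∷; shift; ∈-resp-↭; ↭-length)
open import Data.Product using (_×_; _,_; ∃; proj₁; proj₂)
open import Data.Sum using (inj₁; inj₂)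
open import Data.Empty using (⊥; ⊥-elim)
open import Relation.Nullary.Reflects using (ofʸ; ofⁿ)
open import Relation.Binary.PropositionalEquality

open ≡-Reasoning

+-exchange : ∀ a b c → a + (b + c) ≡ b + (a + c)
+-exchange = solve-∀

other : Step → Step
other S = W
other W = S

count : Step → List Step → ℕ
count s []       = 0
count S (S ∷ p)  = suc (count S p)
count S (W ∷ p)  = count S p
count W (W ∷ p)  = suc (count W p)
count W (S ∷ p)  = count W p

count-S : ∀ p → count S p ≡ countS p
count-S []      = refl
count-S (S ∷ p) = cong suc (count-S p)
count-S (W ∷ p) = count-S p

count-split : ∀ s p → count (other s) p + count s p ≡ length p
count-split s []      = refl
count-split S (S ∷ p) = trans (+-suc (count W p) (count S p)) (cong suc (count-split S p))
count-split S (W ∷ p) = cong suc (count-split S p)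
count-split W (W ∷ p) = trans (+-suc (count S p) (count W p)) (cong suc (count-split W p))
count-split W (S ∷ p) = cong suc (count-split W p)

count-∷ : ∀ s t p → count s p ≤ count s (t ∷ p)
count-∷ S S p = n≤1+n (count S p)
count-∷ S W p = ≤-refl
count-∷ W W p = n≤1+n (count W p)
count-∷ W S p = ≤-refl

path-counts : ∀ {n m} p → IsPath n m p → count S p ≡ m × count W p ≡ n
path-counts {n} {m} p (lp , cp) = cS , +-cancelˡ-≡ m (count W p) n (begin
    m + count W p          ≡⟨ cong (_+ count W p) (sym cS) ⟩
    count S p + count W p  ≡⟨ +-comm (count S p) (count W p) ⟩
    count W p + count S p  ≡⟨ count-split S p ⟩
    length p               ≡⟨ lp ⟩
    m + n                  ∎)
  where
  cS : count S p ≡ m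
  cS = trans (count-S p) cp

-- Picking along a path

pick : {X : Set} → Step → List Step → List X → List X
pick s []      xs       = []
pick s (_ ∷ _) []       = []
pick S (S ∷ p) (x ∷ xs) = x ∷ pick S p xs
pick S (W ∷ p) (x ∷ xs) = pick S p xs
pick W (W ∷ p) (x ∷ xs) = x ∷ pick W p xs
pick W (S ∷ p) (x ∷ xs) = pick W p xs

length-pick : {X : Set} → ∀ s p (xs : List X) → length p ≡ length xs → length (pick s p xs) ≡ count s p
length-pick s []      []       e = refl
length-pick S (S ∷ p) (x ∷ xs) e = cong suc (length-pick S p xs (suc-injective e))
length-pick S (W ∷ p) (x ∷ xs) e = length-pick S p xs (suc-injective e)
length-pick W (W ∷ p) (x ∷ xs) e = cong suc (length-pick W p xs (suc-injective e))
length-pick W (S ∷ p) (x ∷ xs) e = length-pick W p xs (suc-injective e)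

pick-zipWith : {X Y Z : Set} (f : X → Y → Z) → ∀ s p xs ys →
  pick s p (zipWith f xs ys) ≡ zipWith f (pick s p xs) (pick s p ys)
pick-zipWith f s []      xs       ys       = refl
pick-zipWith f s (_ ∷ _) []       ys       = refl
pick-zipWith f s (t ∷ p) (x ∷ xs) []       = sym (zipWith-zeroʳ f (pick s (t ∷ p) (x ∷ xs)))
pick-zipWith f S (S ∷ p) (x ∷ xs) (y ∷ ys) = cong (f x y ∷_) (pick-zipWith f S p xs ys)
pick-zipWith f S (W ∷ p) (x ∷ xs) (y ∷ ys) = pick-zipWith f S p xs ys
pick-zipWith f W (W ∷ p) (x ∷ xs) (y ∷ ys) = cong (f x y ∷_) (pick-zipWith f W p xs ys)
pick-zipWith f W (S ∷ p) (x ∷ xs) (y ∷ ys) = pick-zipWith f W p xs ys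

pick-All : {X : Set} {P : X → Set} → ∀ s p {xs} → All P xs → All P (pick s p xs)
pick-All s []      _          = []
pick-All s (_ ∷ _) []         = []
pick-All S (S ∷ p) (px ∷ pxs) = px ∷ pick-All S p pxs
pick-All S (W ∷ p) (px ∷ pxs) = pick-All S p pxs
pick-All W (W ∷ p) (px ∷ pxs) = px ∷ pick-All W p pxs
pick-All W (S ∷ p) (px ∷ pxs) = pick-All W p pxs

pick-AllPairs : {X : Set} {R : X → X → Set} → ∀ s p {xs} → AllPairs R xs → AllPairs R (pick s p xs)
pick-AllPairs s []      _          = []
pick-AllPairs s (_ ∷ _) []         = []
pick-AllPairs S (S ∷ p) (px ∷ pxs) = pick-All S p px ∷ pick-AllPairs S p pxs
pick-AllPairs S (W ∷ p) (px ∷ pxs) = pick-AllPairs S p pxs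
pick-AllPairs W (W ∷ p) (px ∷ pxs) = pick-All W p px ∷ pick-AllPairs W p pxs
pick-AllPairs W (S ∷ p) (px ∷ pxs) = pick-AllPairs W p pxs

pick-↭ : {X : Set} → ∀ p (xs : List X) → length p ≡ length xs → xs ↭ pick S p xs ++ pick W p xs
pick-↭ []      []       e = ↭-refl
pick-↭ (S ∷ p) (x ∷ xs) e = ↭-prep x (pick-↭ p xs (suc-injective e))
pick-↭ (W ∷ p) (x ∷ xs) e =
  ↭-trans (↭-prep x (pick-↭ p xs (suc-injective e))) (↭-sym (shift x (pick S p xs) (pick W p xs)))

times : ℕ → ℕ → List ℕ
times k zero    = []
times k (suc l) = k ∷ times (suc k) l

map-times-suc : {X : Set} (f : ℕ → X) → ∀ k l → map f (times (suc k) l) ≡ map (λ v → f (suc v)) (times k l)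
map-times-suc f k zero    = refl
map-times-suc f k (suc l) = cong (f (suc k) ∷_) (map-times-suc f (suc k) l)

nth-times : ∀ xs → map (nth xs) (times 1 (length xs)) ≡ xs
nth-times []       = refl
nth-times (x ∷ xs) = cong (x ∷_) (begin
  map (nth (x ∷ xs)) (times 2 (length xs))             ≡⟨ map-times-suc (nth (x ∷ xs)) 1 (length xs) ⟩
  map (λ v → nth (x ∷ xs) (suc v)) (times 1 (length xs)) ≡⟨ map-times-suc (λ v → nth (x ∷ xs) (suc v)) 0 (length xs) ⟩
  map (λ v → nth xs (suc v)) (times 0 (length xs))     ≡⟨ sym (map-times-suc (nth xs) 0 (length xs)) ⟩
  map (nth xs) (times 1 (length xs))                   ≡⟨ nth-times xs ⟩
  xs                                                   ∎)

pick-times : {X : Set} (f : ℕ → X) → ∀ s k p → pick s p (map f (times k (length p))) ≡ map f (posOf s k p)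
pick-times f s k []      = refl
pick-times f S k (S ∷ p) = cong (f k ∷_) (pick-times f S (suc k) p)
pick-times f S k (W ∷ p) = pick-times f S (suc k) p
pick-times f W k (W ∷ p) = cong (f k ∷_) (pick-times f W (suc k) p)
pick-times f W k (S ∷ p) = pick-times f W (suc k) p

sub-pick : ∀ s p lam → length lam ≡ length p → sub lam (posOf s 1 p) ≡ pick s p lam
sub-pick s p lam e = begin
  map (nth lam) (posOf s 1 p)                    ≡⟨ sym (pick-times (nth lam) s 1 p) ⟩
  pick s p (map (nth lam) (times 1 (length p)))  ≡⟨ cong (λ L → pick s p (map (nth lam) (times 1 L))) (sym e) ⟩
  pick s p (map (nth lam) (times 1 (length lam))) ≡⟨ cong (pick s p) (nth-times lam) ⟩
  pick s p lam                                   ∎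

StrictlyDecreasing : List ℕ → Set
StrictlyDecreasing = AllPairs _>_

>-trans : ∀ {a b c} → a > b → b > c → a > c
>-trans a>b b>c = <-trans b>c a>b

head-not-below : ∀ {x xs ys} → x ∷ xs ≡ ys → All (_< x) ys → ⊥
head-not-below refl (x<x ∷ _) = <-irrefl refl x<x

pick-injective : ∀ p q xs → StrictlyDecreasing xs → length p ≡ length xs → length q ≡ length xs →
  pick S p xs ≡ pick S q xs → p ≡ q
pick-injective []      []      []       _          _  _  _ = refl
pick-injective (S ∷ p) (S ∷ q) (x ∷ xs) (_ ∷ dec) ep eq e =
  cong (S ∷_) (pick-injective p q xs dec (suc-injective ep) (suc-injective eq) (∷-injectiveʳ e))
pick-injective (W ∷ p) (W ∷ q) (x ∷ xs) (_ ∷ dec) ep eq e =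
  cong (W ∷_) (pick-injective p q xs dec (suc-injective ep) (suc-injective eq) e)
pick-injective (S ∷ p) (W ∷ q) (x ∷ xs) (x>xs ∷ _) _ _ e = ⊥-elim (head-not-below e (pick-All S q x>xs))
pick-injective (W ∷ p) (S ∷ q) (x ∷ xs) (x>xs ∷ _) _ _ e = ⊥-elim (head-not-below (sym e) (pick-All S p x>xs))

member-≤-head : ∀ {z x xs} → StrictlyDecreasing (x ∷ xs) → z ∈ x ∷ xs → z ≤ x
member-≤-head _            (here refl) = ≤-refl
member-≤-head (x>xs ∷ _)   (there z∈) = <⇒≤ (All.lookup x>xs z∈)

same-head : ∀ {x y xs ys} → StrictlyDecreasing (x ∷ xs) → StrictlyDecreasing (y ∷ ys) →
  y ∈ x ∷ xs → x ∈ y ∷ ys → x ≡ y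
same-head decx decy y∈ x∈ = ≤-antisym (member-≤-head decy x∈) (member-≤-head decx y∈)

merge : ∀ xs ys zs → StrictlyDecreasing xs → StrictlyDecreasing ys → StrictlyDecreasing zs →
  xs ↭ ys ++ zs → ∃ λ p → length p ≡ length xs × pick S p xs ≡ ys × pick W p xs ≡ zs
merge [] [] [] _ _ _ _ = [] , refl , refl , refl
merge [] (y ∷ ys) zs _ _ _ xs↭ with ↭-length xs↭
... | ()
merge [] [] (z ∷ zs) _ _ _ xs↭ with ↭-length xs↭
... | ()
merge (x ∷ xs) ys zs decx decy decz xs↭ with ∈-++⁻ ys (∈-resp-↭ xs↭ (here refl))
merge (x ∷ xs) (y ∷ ys) zs decx decy decz xs↭ | inj₁ x∈ys
  with same-head decx decy (∈-resp-↭ (↭-sym xs↭) (here refl)) x∈ys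
merge (x ∷ xs) (.x ∷ ys) zs (_ ∷ decx) (_ ∷ decy) decz xs↭ | inj₁ _ | refl
  with merge xs ys zs decx decy decz (drop-∷ xs↭)
... | p , lp , eS , eW = S ∷ p , cong suc lp , cong (x ∷_) eS , eW
merge (x ∷ xs) ys (z ∷ zs) decx decy decz xs↭ | inj₂ x∈zs
  with same-head decx decz (∈-resp-↭ (↭-sym xs↭) (∈-++⁺ʳ ys (here refl))) x∈zs
merge (x ∷ xs) ys (.x ∷ zs) (_ ∷ decx) decy (_ ∷ decz) xs↭ | inj₂ _ | refl
  with merge xs ys zs decx decy decz (drop-∷ (↭-trans xs↭ (shift x ys zs)))
... | p , lp , eS , eW = W ∷ p , cong suc lp , eS , cong (x ∷_) eW

-- Partitions versus strictly decreasing lists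

weak⇒strict : ∀ xs → Linked _≥_ xs → Linked _>_ (xs ⊕ ρ (length xs))
weak⇒strict []           []        = []
weak⇒strict (x ∷ [])     [-]       = [-]
weak⇒strict (x ∷ y ∷ xs) (x≥y ∷ h) =
  subst (y + length xs <_) (sym (+-suc x (length xs))) (s≤s (+-monoˡ-≤ (length xs) x≥y)) ∷ weak⇒strict (y ∷ xs) h

strict⇒weak : ∀ xs k → length xs ≡ k → Linked _>_ (xs ⊕ ρ k) → Linked _≥_ xs
strict⇒weak []           k               e h = []
strict⇒weak (x ∷ [])     k               e h = [-]
strict⇒weak (x ∷ y ∷ xs) (suc (suc k)) e (r ∷ h) =
  +-cancelʳ-≤ k y x (≤-pred (subst (y + k <_) (+-suc x k) r)) ∷ strict⇒weak (y ∷ xs) (suc k) (suc-injective e) h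

partition⇒strict : ∀ {k xs} → IsPartLen k xs → StrictlyDecreasing (xs ⊕ ρ k)
partition⇒strict {xs = xs} (refl , weak) = Linked⇒AllPairs >-trans (weak⇒strict xs weak)

strict⇒partition : ∀ {k xs} → length xs ≡ k → StrictlyDecreasing (xs ⊕ ρ k) → IsPartLen k xs
strict⇒partition {k} {xs} e dec = e , strict⇒weak xs k e (AllPairs⇒Linked dec)

length-⊕ρ : ∀ {k} xs → length xs ≡ k → length (xs ⊕ ρ k) ≡ k
length-⊕ρ {k} xs refl = trans (length-zipWith _+_ xs (ρ k)) (trans (cong (k ⊓_) (length-downFrom k)) (⊓-idem k))

⊕-exchange : ∀ xs ys zs → (xs ⊕ ys) ⊕ zs ≡ ys ⊕ (xs ⊕ zs)
⊕-exchange []       ys       zs       = sym (zipWith-zeroʳ _+_ ys)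
⊕-exchange (x ∷ xs) []       zs       = refl
⊕-exchange (x ∷ xs) (y ∷ ys) []       = refl
⊕-exchange (x ∷ xs) (y ∷ ys) (z ∷ zs) = cong₂ _∷_ (trans (+-assoc x y z) (+-exchange x y z)) (⊕-exchange xs ys zs)

⊕ρ-cancel : ∀ {k} xs ys → length xs ≡ k → length ys ≡ k → xs ⊕ ρ k ≡ ys ⊕ ρ k → xs ≡ ys
⊕ρ-cancel []       []       _    _  _ = refl
⊕ρ-cancel []       (_ ∷ _)  refl ()
⊕ρ-cancel (x ∷ xs) (y ∷ ys) refl ey h =
  cong₂ _∷_ (+-cancelʳ-≡ (length xs) x y (∷-injectiveˡ h)) (⊕ρ-cancel xs ys refl (suc-injective ey) (∷-injectiveʳ h))

-- Counting later steps

suffixCounts : Step → List Step → List ℕ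
suffixCounts s []      = []
suffixCounts s (_ ∷ p) = count s p ∷ suffixCounts s p

length-suffixCounts : ∀ s p → length (suffixCounts s p) ≡ length p
length-suffixCounts s []      = refl
length-suffixCounts s (_ ∷ p) = cong suc (length-suffixCounts s p)

laterOthers : Step → List Step → List ℕ
laterOthers s p = pick s p (suffixCounts (other s) p)

pick-own-suffix : ∀ s p → pick s p (suffixCounts s p) ≡ ρ (count s p)
pick-own-suffix s []      = refl
pick-own-suffix S (S ∷ p) = cong (count S p ∷_) (pick-own-suffix S p)
pick-own-suffix S (W ∷ p) = pick-own-suffix S p
pick-own-suffix W (W ∷ p) = cong (count W p ∷_) (pick-own-suffix W p)
pick-own-suffix W (S ∷ p) = pick-own-suffix W p

suffixCounts-ρ : ∀ s p → suffixCounts (other s) p ⊕ suffixCounts s p ≡ ρ (length p)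
suffixCounts-ρ s []      = refl
suffixCounts-ρ s (_ ∷ p) = cong₂ _∷_ (count-split s p) (suffixCounts-ρ s p)

suffixCounts-bounded : ∀ s p → All (_≤ count s p) (suffixCounts s p)
suffixCounts-bounded s []      = []
suffixCounts-bounded s (t ∷ p) =
  count-∷ s t p ∷ All.map (λ le → ≤-trans le (count-∷ s t p)) (suffixCounts-bounded s p)

-- Adding ρ to laterOthers gives the pick of ρ_{|p|}: the number of all later steps.
laterOthers-ρ : ∀ s p → laterOthers s p ⊕ ρ (count s p) ≡ pick s p (ρ (length p))
laterOthers-ρ s p = begin
  pick s p (suffixCounts (other s) p) ⊕ ρ (count s p)
    ≡⟨ cong (pick s p (suffixCounts (other s) p) ⊕_) (sym (pick-own-suffix s p)) ⟩
  pick s p (suffixCounts (other s) p) ⊕ pick s p (suffixCounts s p)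
    ≡⟨ sym (pick-zipWith _+_ s p (suffixCounts (other s) p) (suffixCounts s p)) ⟩
  pick s p (suffixCounts (other s) p ⊕ suffixCounts s p)
    ≡⟨ cong (pick s p) (suffixCounts-ρ s p) ⟩
  pick s p (ρ (length p)) ∎

-- One entry of the formula n + i - V_i: if w other steps precede the i-th
-- s-step (at time k = i + w) and there are b = w + c other steps in total,
-- it equals the number c of other steps after it.
stair-entry : ∀ {b i w k c} → k ≡ i + w → w + c ≡ b → b + i ∸ k ≡ c
stair-entry {i = i} {w} {c = c} refl refl = begin
  w + c + i ∸ (i + w)  ≡⟨ cong (_∸ (i + w)) (reorder w c i) ⟩
  i + w + c ∸ (i + w)  ≡⟨ m+n∸m≡n (i + w) c ⟩
  c                    ∎
  where
  reorder : ∀ w c i → w + c + i ≡ i + w + c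
  reorder = solve-∀

next-other : ∀ {k i w} → k ≡ i + w → suc k ≡ i + suc w
next-other {i = i} {w} k≡ = trans (cong suc k≡) (sym (+-suc i w))

stair : ∀ s b i w k p → k ≡ i + w → w + count (other s) p ≡ b →
  withIdx (λ i v → b + i ∸ v) i (posOf s k p) ≡ laterOthers s p
stair s b i w k []      _  _ = refl
stair S b i w k (S ∷ p) k≡ b≡ = cong₂ _∷_ (stair-entry k≡ b≡) (stair S b (suc i) w (suc k) p (cong suc k≡) b≡)
stair S b i w k (W ∷ p) k≡ b≡ = stair S b i (suc w) (suc k) p (next-other k≡) (trans (sym (+-suc w _)) b≡)
stair W b i w k (W ∷ p) k≡ b≡ = cong₂ _∷_ (stair-entry k≡ b≡) (stair W b (suc i) w (suc k) p (cong suc k≡) b≡)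
stair W b i w k (S ∷ p) k≡ b≡ = stair W b i (suc w) (suc k) p (next-other k≡) (trans (sym (+-suc w _)) b≡)

component : Step → List ℕ → List Step → List ℕ
component s lam p = laterOthers s p ⊕ pick s p lam

length-component : ∀ s lam p → length lam ≡ length p → length (component s lam p) ≡ count s p
length-component s lam p e = begin
  length (component s lam p)
    ≡⟨ length-zipWith _+_ (laterOthers s p) (pick s p lam) ⟩
  length (laterOthers s p) ⊓ length (pick s p lam)
    ≡⟨ cong₂ _⊓_ (length-pick s p _ (sym (length-suffixCounts (other s) p))) (length-pick s p lam (sym e)) ⟩
  count s p ⊓ count s p ≡⟨ ⊓-idem (count s p) ⟩
  count s p ∎

component-ρ : ∀ s lam p {c L} → count s p ≡ c → length p ≡ L →
  component s lam p ⊕ ρ c ≡ pick s p (lam ⊕ ρ L)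
component-ρ s lam p refl refl = begin
  (laterOthers s p ⊕ pick s p lam) ⊕ ρ (count s p)  ≡⟨ ⊕-exchange (laterOthers s p) (pick s p lam) _ ⟩
  pick s p lam ⊕ (laterOthers s p ⊕ ρ (count s p))  ≡⟨ cong (pick s p lam ⊕_) (laterOthers-ρ s p) ⟩
  pick s p lam ⊕ pick s p (ρ (length p))            ≡⟨ sym (pick-zipWith _+_ s p lam (ρ (length p))) ⟩
  pick s p (lam ⊕ ρ (length p))                     ∎

muOf-path : ∀ {m n} p → IsPath n m p → muOf n p ≡ laterOthers S p
muOf-path p path = stair S _ 1 0 1 p refl (proj₂ (path-counts p path))

nuConjOf-path : ∀ {m n} p → IsPath n m p → nuConjOf m p ≡ laterOthers W p
nuConjOf-path p path = stair W _ 1 0 1 p refl (proj₁ (path-counts p path))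

Φ-components : ∀ {m n lam} p → IsPath n m p → length lam ≡ m + n →
  Φ m n lam p ≡ (component S lam p , component W lam p)
Φ-components {lam = lam} p path@(lp , _) lenLam =
  cong₂ _,_ (cong₂ _⊕_ (muOf-path p path) (sub-pick S p lam e))
            (cong₂ _⊕_ (nuConjOf-path p path) (sub-pick W p lam e))
  where
  e : length lam ≡ length p
  e = trans lenLam (sym lp)

-- Size of a conjugate

hits : ℕ → ℕ → ℕ → ℕ
hits x i zero    = 0
hits x i (suc k) = (if x <ᵇ i then 0 else 1) + hits x (suc i) k

columns : ℕ → ℕ → List ℕ → List ℕ
columns i k xs = withIdx (λ l _ → countGe l xs) i (downFrom k)

columns-[] : ∀ i k → sum (columns i k []) ≡ 0
columns-[] i zero    = refl
columns-[] i (suc k) = columns-[] (suc i) k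

columns-∷ : ∀ x xs i k → sum (columns i k (x ∷ xs)) ≡ hits x i k + sum (columns i k xs)
columns-∷ x xs i zero    = refl
columns-∷ x xs i (suc k) with x <ᵇ i
... | true  = trans (cong (countGe i xs +_) (columns-∷ x xs (suc i) k))
                    (+-exchange (countGe i xs) (hits x (suc i) k) _)
... | false = cong suc (trans (cong (countGe i xs +_) (columns-∷ x xs (suc i) k))
                              (+-exchange (countGe i xs) (hits x (suc i) k) _))

hits-shift : ∀ x i k → hits (suc x) (suc i) k ≡ hits x i k
hits-shift x i zero    = refl
hits-shift x i (suc k) = cong ((if x <ᵇ i then 0 else 1) +_) (hits-shift x (suc i) k)

hits-zero : ∀ i k → hits 0 (suc i) k ≡ 0
hits-zero i zero    = refl
hits-zero i (suc k) = hits-zero (suc i) k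

hits-min : ∀ x k → hits x 1 k ≡ x ⊓ k
hits-min zero    k       = hits-zero 0 k
hits-min (suc x) zero    = refl
hits-min (suc x) (suc k) = cong suc (trans (hits-shift x 1 k) (hits-min x k))

-- A partition and its conjugate have the same size, provided every part is at
-- most k so that the conjugate has at most k parts.
conj-size : ∀ k xs → All (_≤ k) xs → size (conj k xs) ≡ sum xs
conj-size k []       []          = columns-[] 1 k
conj-size k (x ∷ xs) (x≤k ∷ xs≤k) = begin
  sum (columns 1 k (x ∷ xs))          ≡⟨ columns-∷ x xs 1 k ⟩
  hits x 1 k + sum (columns 1 k xs)   ≡⟨ cong₂ _+_ (trans (hits-min x k) (m≤n⇒m⊓n≡m x≤k)) (conj-size k xs xs≤k) ⟩
  x + sum xs                          ∎

-- Double counting: each (south, west) pair of steps is counted once, by the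
-- earlier step of the pair.
crossings-total : ∀ p → sum (laterOthers S p) + sum (laterOthers W p) ≡ count S p * count W p
crossings-total []      = refl
crossings-total (S ∷ p) = begin
  count W p + sum (laterOthers S p) + sum (laterOthers W p)   ≡⟨ +-assoc (count W p) _ _ ⟩
  count W p + (sum (laterOthers S p) + sum (laterOthers W p)) ≡⟨ cong (count W p +_) (crossings-total p) ⟩
  count W p + count S p * count W p                           ∎
crossings-total (W ∷ p) = begin
  sum (laterOthers S p) + (count S p + sum (laterOthers W p)) ≡⟨ +-exchange (sum (laterOthers S p)) (count S p) _ ⟩
  count S p + (sum (laterOthers S p) + sum (laterOthers W p)) ≡⟨ cong (count S p +_) (crossings-total p) ⟩
  count S p + count S p * count W p                           ≡⟨ sym (*-suc (count S p) (count W p)) ⟩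
  count S p * suc (count W p)                                 ∎

-- Inversions of a picked pair

countGt-∷-> : ∀ {x y} ys → x < y → countGt x (y ∷ ys) ≡ suc (countGt x ys)
countGt-∷-> {x} {y} ys x<y with x <ᵇ y | <ᵇ-reflects-< x y
... | true  | _       = refl
... | false | ofⁿ x≮y = ⊥-elim (x≮y x<y)

countGt-∷-≤ : ∀ {x y} ys → y ≤ x → countGt x (y ∷ ys) ≡ countGt x ys
countGt-∷-≤ {x} {y} ys y≤x with x <ᵇ y | <ᵇ-reflects-< x y
... | true  | ofʸ x<y = ⊥-elim (<⇒≱ x<y y≤x)
... | false | _       = refl

countGt-++ : ∀ x ys zs → countGt x (ys ++ zs) ≡ countGt x ys + countGt x zs
countGt-++ x []       zs = refl
countGt-++ x (y ∷ ys) zs with x <ᵇ y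
... | true  = cong suc (countGt-++ x ys zs)
... | false = countGt-++ x ys zs

countGt-below : ∀ {x ys} → All (_< x) ys → countGt x ys ≡ 0
countGt-below                 []           = refl
countGt-below {x} {y ∷ ys} (y<x ∷ ys<x) = trans (countGt-∷-≤ {x} {y} ys (<⇒≤ y<x)) (countGt-below ys<x)

crossSum : List ℕ → List ℕ → ℕ
crossSum []       ys = 0
crossSum (x ∷ xs) ys = countGt x ys + crossSum xs ys

crossSum-∷-above : ∀ {y} xs ys → All (_< y) xs → crossSum xs (y ∷ ys) ≡ length xs + crossSum xs ys
crossSum-∷-above     []       ys []           = refl
crossSum-∷-above {y} (x ∷ xs) ys (x<y ∷ xs<y) = begin
  countGt x (y ∷ ys) + crossSum xs (y ∷ ys)        ≡⟨ cong₂ _+_ (countGt-∷-> ys x<y) (crossSum-∷-above xs ys xs<y) ⟩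
  suc (countGt x ys) + (length xs + crossSum xs ys) ≡⟨ cong suc (+-exchange (countGt x ys) (length xs) _) ⟩
  suc (length xs + (countGt x ys + crossSum xs ys)) ∎

inv-++ : ∀ xs ys → inv (xs ++ ys) ≡ inv xs + crossSum xs ys + inv ys
inv-++ []       ys = refl
inv-++ (x ∷ xs) ys = trans (cong₂ _+_ (countGt-++ x xs ys) (inv-++ xs ys)) (regroup (countGt x xs) _ _ _ _)
  where
  regroup : ∀ a b c d e → a + b + (c + d + e) ≡ a + c + (b + d) + e
  regroup = solve-∀

inv-decreasing : ∀ {xs} → StrictlyDecreasing xs → inv xs ≡ 0
inv-decreasing []             = refl
inv-decreasing (x>xs ∷ dec) = cong₂ _+_ (countGt-below x>xs) (inv-decreasing dec)

crossSum-pick : ∀ p xs → StrictlyDecreasing xs → length p ≡ length xs →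
  crossSum (pick S p xs) (pick W p xs) ≡ sum (laterOthers W p)
crossSum-pick []      []       _            _ = refl
crossSum-pick (S ∷ p) (x ∷ xs) (x>xs ∷ dec) e =
  cong₂ _+_ (countGt-below (pick-All W p x>xs)) (crossSum-pick p xs dec (suc-injective e))
crossSum-pick (W ∷ p) (x ∷ xs) (x>xs ∷ dec) e = begin
  crossSum (pick S p xs) (x ∷ pick W p xs)                 ≡⟨ crossSum-∷-above _ _ (pick-All S p x>xs) ⟩
  length (pick S p xs) + crossSum (pick S p xs) (pick W p xs)
    ≡⟨ cong₂ _+_ (length-pick S p xs (suc-injective e)) (crossSum-pick p xs dec (suc-injective e)) ⟩
  count S p + sum (laterOthers W p)                        ∎

inv-pick : ∀ p xs → StrictlyDecreasing xs → length p ≡ length xs →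
  inv (pick S p xs ++ pick W p xs) ≡ sum (laterOthers W p)
inv-pick p xs dec e = begin
  inv (pick S p xs ++ pick W p xs)
    ≡⟨ inv-++ (pick S p xs) (pick W p xs) ⟩
  inv (pick S p xs) + crossSum (pick S p xs) (pick W p xs) + inv (pick W p xs)
    ≡⟨ cong₂ _+_ (cong₂ _+_ (inv-decreasing (pick-AllPairs S p dec)) (crossSum-pick p xs dec e))
                 (inv-decreasing (pick-AllPairs W p dec)) ⟩
  sum (laterOthers W p) + 0
    ≡⟨ +-identityʳ _ ⟩
  sum (laterOthers W p) ∎

module Bijection (m n : ℕ) (lam : List ℕ) (lamPart : IsPartLen (m + n) lam) where

  A : List ℕ
  A = lam ⊕ ρ (m + n)

  A-decreasing : StrictlyDecreasing A
  A-decreasing = partition⇒strict lamPart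

  total : Step → ℕ
  total S = m
  total W = n

  path-count : ∀ s p → IsPath n m p → count s p ≡ total s
  path-count S p path = proj₁ (path-counts p path)
  path-count W p path = proj₂ (path-counts p path)

  path-length : ∀ p → IsPath n m p → length p ≡ length A
  path-length p (lp , _) = trans lp (sym (length-⊕ρ lam (proj₁ lamPart)))

  shifted : ∀ s p → IsPath n m p → component s lam p ⊕ ρ (total s) ≡ pick s p A
  shifted s p path@(lp , _) = component-ρ s lam p (path-count s p path) lp

  length-component-path : ∀ s p → IsPath n m p → length (component s lam p) ≡ total s
  length-component-path s p path@(lp , _) =
    trans (length-component s lam p (trans (proj₁ lamPart) (sym lp))) (path-count s p path)

  component-partition : ∀ s p → IsPath n m p → IsPartLen (total s) (component s lam p)
  component-partition s p path = strict⇒partition (length-component-path s p path)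
    (subst StrictlyDecreasing (sym (shifted s p path)) (pick-AllPairs s p A-decreasing))

  -- Φ maps 𝔓(n,m) into the target: the picks of A are strictly decreasing and
  -- together a rearrangement of A.
  Φ-target : (p : List Step) → IsPath n m p → Target m n lam (Φ m n lam p)
  Φ-target p path = subst (Target m n lam) (sym (Φ-components p path (proj₁ lamPart)))
    ( component-partition S p path
    , component-partition W p path
    , lamPart
    , subst (A ↭_) (sym (cong₂ _++_ (shifted S p path) (shifted W p path))) (pick-↭ p A (path-length p path)) )

  -- Φ is injective: the south components determine the south pick of A.
  Φ-injective : (p q : List Step) → IsPath n m p → IsPath n m q → Φ m n lam p ≡ Φ m n lam q → p ≡ q
  Φ-injective p q pathp pathq e =
    pick-injective p q A A-decreasing (path-length p pathp) (path-length q pathq) (begin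
      pick S p A               ≡⟨ sym (shifted S p pathp) ⟩
      component S lam p ⊕ ρ m  ≡⟨ cong (λ Φp → proj₁ Φp ⊕ ρ m) components ⟩
      component S lam q ⊕ ρ m  ≡⟨ shifted S q pathq ⟩
      pick S q A               ∎)
    where
    components : (component S lam p , component W lam p) ≡ (component S lam q , component W lam q)
    components = trans (sym (Φ-components p pathp (proj₁ lamPart))) (trans e (Φ-components q pathq (proj₁ lamPart)))

  -- Φ is onto the target: merging μ + ρ_m and ν + ρ_n back into A gives the path.
  Φ-surjective : (μ ν : List ℕ) → Target m n lam (μ , ν) → ∃ λ p → IsPath n m p × Φ m n lam p ≡ (μ , ν)
  Φ-surjective μ ν (μPart , νPart , _ , A↭) with
    merge A (μ ⊕ ρ m) (ν ⊕ ρ n) A-decreasing (partition⇒strict μPart) (partition⇒strict νPart) A↭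
  ... | p , lp , eS , eW =
    p , path , trans (Φ-components p path (proj₁ lamPart)) (cong₂ _,_ (unshift S μPart eS) (unshift W νPart eW))
    where
    path : IsPath n m p
    path = trans lp (length-⊕ρ lam (proj₁ lamPart)) , (begin
      countS p              ≡⟨ sym (count-S p) ⟩
      count S p             ≡⟨ sym (length-pick S p A lp) ⟩
      length (pick S p A)   ≡⟨ cong length eS ⟩
      length (μ ⊕ ρ m)      ≡⟨ length-⊕ρ μ (proj₁ μPart) ⟩
      m                     ∎)
    unshift : ∀ s {κ} → IsPartLen (total s) κ → pick s p A ≡ κ ⊕ ρ (total s) → component s lam p ≡ κ
    unshift s (lenκ , _) e =
      ⊕ρ-cancel _ _ (length-component-path s p path) lenκ (trans (shifted s p path) e)

  -- The sign: inversions count the (west, later south) pairs, which number |ν(π)|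
  -- and, by double counting, mn - |μ(π)|.
  Φ-sign : (p : List Step) → IsPath n m p →
    (ε m n (proj₁ (Φ m n lam p)) (proj₂ (Φ m n lam p)) ≡ negPow (size (nuOf m p)))
    × (negPow (size (nuOf m p)) ≡ negPow (m * n ∸ size (muOf n p)))
  Φ-sign p path = cong negPow (trans inversions (sym ν-size)) , cong negPow (trans ν-size (sym μ-complement))
    where
    inversions : inv ((proj₁ (Φ m n lam p) ⊕ ρ m) ++ (proj₂ (Φ m n lam p) ⊕ ρ n)) ≡ sum (laterOthers W p)
    inversions = begin
      inv ((proj₁ (Φ m n lam p) ⊕ ρ m) ++ (proj₂ (Φ m n lam p) ⊕ ρ n))
        ≡⟨ cong (λ Φp → inv ((proj₁ Φp ⊕ ρ m) ++ (proj₂ Φp ⊕ ρ n))) (Φ-components p path (proj₁ lamPart)) ⟩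
      inv ((component S lam p ⊕ ρ m) ++ (component W lam p ⊕ ρ n))
        ≡⟨ cong inv (cong₂ _++_ (shifted S p path) (shifted W p path)) ⟩
      inv (pick S p A ++ pick W p A)
        ≡⟨ inv-pick p A A-decreasing (path-length p path) ⟩
      sum (laterOthers W p) ∎
    ν-size : size (nuOf m p) ≡ sum (laterOthers W p)
    ν-size = trans (cong (λ κ → size (conj m κ)) (nuConjOf-path p path))
      (conj-size m (laterOthers W p)
        (subst (λ c → All (_≤ c) (laterOthers W p)) (path-count S p path) (pick-All W p (suffixCounts-bounded S p))))
    μ-complement : m * n ∸ size (muOf n p) ≡ sum (laterOthers W p)
    μ-complement = begin
      m * n ∸ size (muOf n p)
        ≡⟨ cong₂ (λ a b → a * b ∸ size (muOf n p)) (sym (path-count S p path)) (sym (path-count W p path)) ⟩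
      count S p * count W p ∸ size (muOf n p)
        ≡⟨ cong₂ _∸_ (sym (crossings-total p)) (cong size (muOf-path p path)) ⟩
      sum (laterOthers S p) + sum (laterOthers W p) ∸ sum (laterOthers S p)
        ≡⟨ m+n∸m≡n (sum (laterOthers S p)) _ ⟩
      sum (laterOthers W p) ∎

mainTheorem3 : (m n : ℕ) (lam : List ℕ) → IsPartLen (m + n) lam →
    ((p : List Step) → IsPath n m p → Target m n lam (Φ m n lam p))
    × ((p q : List Step) → IsPath n m p → IsPath n m q →
        Φ m n lam p ≡ Φ m n lam q → p ≡ q)
    × ((μ ν : List ℕ) → Target m n lam (μ , ν) →
        ∃ λ p → IsPath n m p × Φ m n lam p ≡ (μ , ν))
    × ((p : List Step) → IsPath n m p →
        (ε m n (proj₁ (Φ m n lam p)) (proj₂ (Φ m n lam p)) ≡ negPow (size (nuOf m p)))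
        × (negPow (size (nuOf m p)) ≡ negPow (m * n ∸ size (muOf n p))))
mainTheorem3 m n lam lamPart = Φ-target , Φ-injective , Φ-surjective , Φ-sign
  where open Bijection m n lam lamPart
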